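{- There exists a function $F:\{0,1\}^*\to\mathbb{N}$ which is in $\#\Sigma_1^{\mathrm{rel}}$ but not in $\#\Sigma_1$.
   Context: Structures: a finite $\sigma$-structure has universe $\{0,\dots,n-1\}$, $n\ge1$; built-in $\le$ (usual order), $\min=0$, $\mathrm{BIT}(i,j)$ iff the $i$-th bit of $j$ is $1$. $\mathrm{enc}_\sigma(\mathcal{A})$ is the standard binary encoding (non-built-in relations as $0/1$ truth values of all tuples in lexicographic order, non-built-in constants in binary of length $\lceil\log_2 n\rceil$; built-ins not encoded). $\#\Sigma_1$: $f:\{0,1\}^*\to\mathbb{N}$ is in $\#\Sigma_1$ if there are a vocabulary $\sigma$ containing built-in $\le,\mathrm{BIT},\min$ and a formula $\varphi(F_1,\dots,F_k,x_1,\dots,x_\ell)=\exists y_1\cdots\exists y_m\,\psi$, $\psi$ quantifier-free, with free function variables $F_i$ of arity $a_i$ (usable in terms) and free individual variables $x_j$, such that for every $\sigma$-structure $\mathcal{A}$, $f(\mathrm{enc}_\sigma(\mathcal{A}))$ is the number of tuples $(f_1,\dots,f_k,c_1,\dots,c_\ell)$ with $f_i:\mathrm{dom}(\mathcal{A})^{a_i}\to\mathrm{dom}(\mathcal{A})$, $c_j\in\mathrm{dom}(\mathcal{A})$, $\mathcal{A}\models\varphi(\bar f,\bar c)$. $\#\Sigma_1^{\mathrm{rel}}$: defined the same way except that $\sigma$ has only the built-in linear order $\le$, and $\varphi(R_1,\dots,R_k,x_1,\dots,x_\ell)=\exists y_1\cdots\exists y_m\,\psi$ has free relation variables $R_i$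 instead of function variables; one counts tuples $(S_1,\dots,S_k,c_1,\dots,c_\ell)$ of relations of the appropriate arities on $\mathrm{dom}(\mathcal{A})$ and elements with $\mathcal{A}\models\varphi(\bar S,\bar c)$. -}

module Defs where

open import Data.Bool using (Bool; true; false; _∧_; _∨_; not)
open import Data.Nat using (ℕ; zero; suc; _+_; _≡ᵇ_; _/_; _%_)
open import Data.Nat.Logarithm using (⌈log₂_⌉)
open import Data.Fin using (Fin; toℕ; _≟_; _≤?_) renaming (zero to fzero; suc to fsuc)
open import Data.List using (List; []; _∷_; length; lookup; map; concatMap; _++_; reverse; allFin)
open import Data.Bool.ListAction using (any)
open import Data.Vec using (Vec; []; _∷_)
import Data.Vec as Vec
open import Data.Product using (Σ; _×_; _,_; proj₁; proj₂)
open import Data.Unit using (⊤; tt)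
open import Relation.Nullary.Decidable using (⌊_⌋)
open import Relation.Binary.PropositionalEquality using (_≡_)
open import Function.Bundles using (_↔_)

BitString : Set
BitString = List Bool

-- Vocabularies: the NON-built-in symbols (relation symbols with arities,
-- and a number of constant symbols).  Built-ins are determined by the mode.

record Vocab : Set where
  field
    rels   : List ℕ
    consts : ℕ

open Vocab public

-- full : built-ins ≤, BIT, min; free second-order variables are FUNCTIONS
-- rel  : built-in ≤ only;      free second-order variables are RELATIONS
data Mode : Set where
  full rel : Mode

record Struct (σ : Vocab) (n : ℕ) : Set where
  field
    relI : (i : Fin (length (rels σ))) → Vec (Fin n) (lookup (rels σ) i) → Bool
    conI : Fin (consts σ) → Fin n

open Struct public

allTuples : (n a : ℕ) → List (Vec (Fin n) a)
allTuples n zero = [] ∷ []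
allTuples n (suc a) = concatMap (λ i → map (i ∷_) (allTuples n a)) (allFin n)

lsbBits : ℕ → ℕ → List Bool
lsbBits zero x = []
lsbBits (suc L) x = (x % 2 ≡ᵇ 1) ∷ lsbBits L (x / 2)

binary : ℕ → ℕ → List Bool
binary L x = reverse (lsbBits L x)

encRels : ∀ {n} (as : List ℕ) → ((i : Fin (length as)) → Vec (Fin n) (lookup as i) → Bool) → BitString
encRels {n} [] R = []
encRels {n} (a ∷ as) R = map (R fzero) (allTuples n a) ++ encRels as (λ i → R (fsuc i))

encConsts : ∀ {n} (c : ℕ) → (Fin c → Fin n) → BitString
encConsts {n} zero C = []
encConsts {n} (suc c) C = binary ⌈log₂ n ⌉ (toℕ (C fzero)) ++ encConsts c (λ i → C (fsuc i))

enc : ∀ {σ n} → Struct σ n → BitString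
enc {σ} A = encRels (rels σ) (relI A) ++ encConsts (consts σ) (conI A)

-- Syntax.  ks = arities of the free second-order variables,
-- v = number of individual variables in scope.

data Term (σ : Vocab) (ks : List ℕ) (v : ℕ) : Mode → Set where
  var  : ∀ {M} → Fin v → Term σ ks v M
  con  : ∀ {M} → Fin (consts σ) → Term σ ks v M
  minT : Term σ ks v full
  app  : (i : Fin (length ks)) → Vec (Term σ ks v full) (lookup ks i) → Term σ ks v full

data QF (σ : Vocab) (ks : List ℕ) (v : ℕ) : Mode → Set where
  atom  : ∀ {M} (i : Fin (length (rels σ))) → Vec (Term σ ks v M) (lookup (rels σ) i) → QF σ ks v M
  _≐_   : ∀ {M} → Term σ ks v M → Term σ ks v M → QF σ ks v M
  _≼_   : ∀ {M} → Term σ ks v M → Term σ ks v M → QF σ ks v M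
  bitA  : Term σ ks v full → Term σ ks v full → QF σ ks v full
  rvar  : (i : Fin (length ks)) → Vec (Term σ ks v rel) (lookup ks i) → QF σ ks v rel
  ¬'_   : ∀ {M} → QF σ ks v M → QF σ ks v M
  _∧'_  : ∀ {M} → QF σ ks v M → QF σ ks v M → QF σ ks v M
  _∨'_  : ∀ {M} → QF σ ks v M → QF σ ks v M → QF σ ks v M

-- φ(x_1..x_ℓ) = ∃ y_1 … ∃ y_m ψ ; in ψ, variables 0..ℓ-1 are the x's,
-- variables ℓ..ℓ+m-1 are the y's.
record Σ₁Formula (M : Mode) (σ : Vocab) (ks : List ℕ) (ℓ : ℕ) : Set where
  field
    m    : ℕ
    body : QF σ ks (ℓ + m) M

open Σ₁Formula public

FunTable : ℕ → ℕ → Set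
FunTable n zero = Fin n
FunTable n (suc a) = Vec (FunTable n a) n

applyF : ∀ {n a} → FunTable n a → Vec (Fin n) a → Fin n
applyF {a = zero} f [] = f
applyF {a = suc a} f (i ∷ is) = applyF (Vec.lookup f i) is

RelTable : ℕ → ℕ → Set
RelTable n zero = Bool
RelTable n (suc a) = Vec (RelTable n a) n

applyR : ∀ {n a} → RelTable n a → Vec (Fin n) a → Bool
applyR {a = zero} r [] = r
applyR {a = suc a} r (i ∷ is) = applyR (Vec.lookup r i) is

SOVal : Mode → ℕ → ℕ → Set
SOVal full n a = FunTable n a
SOVal rel  n a = RelTable n a

SOAssign : Mode → ℕ → List ℕ → Set
SOAssign M n [] = ⊤
SOAssign M n (a ∷ as) = SOVal M n a × SOAssign M n as

soLookup : ∀ {M n} (ks : List ℕ) → SOAssign M n ks → (i : Fin (length ks)) → SOVal M n (lookup ks i)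
soLookup (a ∷ as) (s , ss) fzero = s
soLookup (a ∷ as) (s , ss) (fsuc i) = soLookup as ss i

testBit : ℕ → ℕ → Bool
testBit zero j = j % 2 ≡ᵇ 1
testBit (suc i) j = testBit i (j / 2)

anyVec : ∀ {n} (m : ℕ) → (Vec (Fin n) m → Bool) → Bool
anyVec zero p = p []
anyVec {n} (suc m) p = any (λ i → anyVec m (λ is → p (i ∷ is))) (allFin n)

module _ {σ : Vocab} {ks : List ℕ} {k : ℕ} (A : Struct σ (suc k)) where
  -- universe {0,…,k} (size n = suc k ≥ 1), min = 0

  mutual
    evalT : ∀ {M v} → SOAssign M (suc k) ks → Vec (Fin (suc k)) v → Term σ ks v M → Fin (suc k)
    evalT S ρ (var x) = Vec.lookup ρ x
    evalT S ρ (con c) = conI A c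
    evalT S ρ minT = fzero
    evalT S ρ (app i ts) = applyF (soLookup ks S i) (evalTs S ρ ts)

    evalTs : ∀ {M v a} → SOAssign M (suc k) ks → Vec (Fin (suc k)) v → Vec (Term σ ks v M) a → Vec (Fin (suc k)) a
    evalTs S ρ [] = []
    evalTs S ρ (t ∷ ts) = evalT S ρ t ∷ evalTs S ρ ts

  evalQF : ∀ {M v} → SOAssign M (suc k) ks → Vec (Fin (suc k)) v → QF σ ks v M → Bool
  evalQF S ρ (atom i ts) = relI A i (evalTs S ρ ts)
  evalQF S ρ (s ≐ t) = ⌊ evalT S ρ s ≟ evalT S ρ t ⌋
  evalQF S ρ (s ≼ t) = ⌊ evalT S ρ s ≤? evalT S ρ t ⌋
  evalQF S ρ (bitA s t) = testBit (toℕ (evalT S ρ s)) (toℕ (evalT S ρ t))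
  evalQF S ρ (rvar i ts) = applyR (soLookup ks S i) (evalTs S ρ ts)
  evalQF S ρ (¬' φ) = not (evalQF S ρ φ)
  evalQF S ρ (φ ∧' ψ) = evalQF S ρ φ ∧ evalQF S ρ ψ
  evalQF S ρ (φ ∨' ψ) = evalQF S ρ φ ∨ evalQF S ρ ψ

  sat : ∀ {M ℓ} → Σ₁Formula M σ ks ℓ → SOAssign M (suc k) ks → Vec (Fin (suc k)) ℓ → Bool
  sat φ S c = anyVec (m φ) (λ ys → evalQF S (c Vec.++ ys) (body φ))

  Witnesses : ∀ {M ℓ} → Σ₁Formula M σ ks ℓ → Set
  Witnesses {M} {ℓ} φ = Σ (SOAssign M (suc k) ks × Vec (Fin (suc k)) ℓ) (λ Sc → sat φ (proj₁ Sc) (proj₂ Sc) ≡ true)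

-- The counting classes.  "f(enc A) is the number of witnesses" is expressed
-- as a bijection between Fin (f (enc A)) and the set of witnesses.

InCountClass : Mode → (BitString → ℕ) → Set
InCountClass M f =
  Σ Vocab λ σ → Σ (List ℕ) λ ks → Σ ℕ λ ℓ → Σ (Σ₁Formula M σ ks ℓ) λ φ →
    (k : ℕ) (A : Struct σ (suc k)) → Fin (f (enc A)) ↔ Witnesses A φ

#Σ₁ : (BitString → ℕ) → Set
#Σ₁ = InCountClass full

#Σ₁rel : (BitString → ℕ) → Set
#Σ₁rel = InCountClass rel

-- Over a one-element universe there is exactly one function of each arity and one
-- element, so a #Σ₁ function counts at most one witness on a singleton structure.
-- A nullary relation variable, in contrast, still has two interpretations, so the
-- tautology R ∨ ¬R shows that the constant function 2 is in #Σ₁^rel.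
module Submission where

open import Defs
open import Data.Bool using (Bool; true; false)
open import Data.Bool.Properties using (∨-inverseʳ)
import Data.Bool as Bool
open import Data.Fin using (Fin; zero)
open import Data.Fin.Properties using (2↔Bool; injective⇒≤)
open import Data.List using (List; []; _∷_)
open import Data.Nat using (ℕ; zero; suc; _≤_; s≤s)
open import Data.Product using (Σ; _×_; _,_; proj₁)
open import Data.Unit using (tt)
open import Data.Vec using (Vec; []; _∷_)
open import Function.Bundles using (_↔_; mk↔ₛ′; Injection)
open import Function.Properties.Inverse using (↔-sym; ↔-trans; ↔⇒↣)
open import Relation.Binary.PropositionalEquality using (_≡_; refl; cong; cong₂)
open import Relation.Nullary using (¬_; Irrelevant)
open import Axiom.UniquenessOfIdentityProofs using (module Decidable⇒UIP)

open Decidable⇒UIP Bool._≟_ using () renaming (≡-irrelevant to Bool-≡-irrelevant)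

Σ-valid↔ : {X : Set} (p : X → Bool) → (∀ x → p x ≡ true) → Σ X (λ x → p x ≡ true) ↔ X
Σ-valid↔ p valid = mk↔ₛ′ proj₁ (λ x → x , valid x) (λ _ → refl)
  (λ (x , px) → cong (x ,_) (Bool-≡-irrelevant _ _))

↔-irrelevant⇒≤1 : {n : ℕ} {X : Set} → Fin n ↔ X → Irrelevant X → n ≤ 1
↔-irrelevant⇒≤1 f irr = injective⇒≤ {f = λ _ → zero} (λ _ → Injection.injective (↔⇒↣ f) (irr _ _))

R∨¬R : {σ : Vocab} → Σ₁Formula rel σ (0 ∷ []) 0
R∨¬R = record { m = 0 ; body = rvar zero [] ∨' (¬' rvar zero []) }

nullary-assignments↔Bool : {n : ℕ} → (SOAssign rel n (0 ∷ []) × Vec (Fin n) 0) ↔ Bool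
nullary-assignments↔Bool = mk↔ₛ′ (λ { ((b , tt) , []) → b }) (λ b → (b , tt) , []) (λ _ → refl)
  (λ { ((b , tt) , []) → refl })

witnesses-R∨¬R↔Bool : {σ : Vocab} {k : ℕ} (A : Struct σ (suc k)) → Witnesses A R∨¬R ↔ Bool
witnesses-R∨¬R↔Bool A =
  ↔-trans (Σ-valid↔ _ (λ { ((b , tt) , []) → ∨-inverseʳ b })) nullary-assignments↔Bool

#Σ₁rel-two : #Σ₁rel (λ _ → 2)
#Σ₁rel-two = record { rels = [] ; consts = 0 } , 0 ∷ [] , 0 , R∨¬R ,
  λ k A → ↔-trans 2↔Bool (↔-sym (witnesses-R∨¬R↔Bool A))

FunTable-1-irrelevant : (a : ℕ) → Irrelevant (FunTable 1 a)
FunTable-1-irrelevant zero zero zero = refl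
FunTable-1-irrelevant (suc a) (f ∷ []) (g ∷ []) = cong (_∷ []) (FunTable-1-irrelevant a f g)

SOAssign-1-irrelevant : (ks : List ℕ) → Irrelevant (SOAssign full 1 ks)
SOAssign-1-irrelevant [] tt tt = refl
SOAssign-1-irrelevant (a ∷ as) (f , S) (g , T) =
  cong₂ _,_ (FunTable-1-irrelevant a f g) (SOAssign-1-irrelevant as S T)

Vec-Fin1-irrelevant : (ℓ : ℕ) → Irrelevant (Vec (Fin 1) ℓ)
Vec-Fin1-irrelevant zero [] [] = refl
Vec-Fin1-irrelevant (suc ℓ) (zero ∷ u) (zero ∷ v) = cong (zero ∷_) (Vec-Fin1-irrelevant ℓ u v)

Witnesses-1-irrelevant : {σ : Vocab} {ks : List ℕ} {ℓ : ℕ} (A : Struct σ 1) (φ : Σ₁Formula full σ ks ℓ) →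
                         Irrelevant (Witnesses A φ)
Witnesses-1-irrelevant {ks = ks} {ℓ} A φ ((S , c) , p) ((T , d) , q)
  with SOAssign-1-irrelevant ks S T | Vec-Fin1-irrelevant ℓ c d
... | refl | refl = cong ((S , c) ,_) (Bool-≡-irrelevant p q)

#Σ₁⇒∃value≤1 : {f : BitString → ℕ} → #Σ₁ f → Σ BitString (λ x → f x ≤ 1)
#Σ₁⇒∃value≤1 (σ , ks , ℓ , φ , count) = enc A , ↔-irrelevant⇒≤1 (count 0 A) (Witnesses-1-irrelevant A φ)
  where
  A : Struct σ 1
  A = record { relI = λ _ _ → false ; conI = λ _ → zero }

¬#Σ₁-two : ¬ #Σ₁ (λ _ → 2)
¬#Σ₁-two h with #Σ₁⇒∃value≤1 h
... | _ , s≤s ()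

lemma6 : Σ (BitString → ℕ) (λ F → #Σ₁rel F × ¬ #Σ₁ F)
lemma6 = (λ _ → 2) , #Σ₁rel-two , ¬#Σ₁-two
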